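{- Let $\mathcal{C}$ be a complete code. Then the complement of the general relationship graph $G(\mathcal{C})$ is a complete graph.
   Context: A neural code on $n$ neurons is a collection of subsets of $[n]$. The codeword containment graph of $\mathcal{C}$ has vertex set $\mathcal{C}$, with $\sigma,\tau$ adjacent iff $\sigma\subsetneq\tau$ or $\tau\subsetneq\sigma$; $\mathcal{C}$ is a complete code if this graph is complete. A pseudo-monomial in $\mathbb{F}_2[x_1,\dots,x_n]$ is $\prod_{i\in\sigma}x_i\prod_{j\in\tau}(1-x_j)$ with $\sigma\cap\tau=\emptyset$. For an ideal $J$, a pseudo-monomial $f\in J$ is minimal if there is no pseudo-monomial $g\in J$ with $\deg g<\deg f$ and $g\mid f$; $\mathrm{CF}(J)$ is the set of minimal pseudo-monomials of $J$. With $\rho_v=\prod_{i\in v}x_i\prod_{j\notin v}(1-x_j)$, the neural ideal is $\mathcal{J}_\mathcal{C}=\langle\rho_v\mid v\subseteq[n],v\notin\mathcal{C}\rangle$. For $\sigma\subseteq[n]$ let $E_\sigma=\{x_i,1-x_i\mid i\in\sigma\}$. The general relationship complex is $GR(\mathcal{C})=\{\sigma\subseteq[n]\mid \prod_{\gamma\in\Gamma}\gamma\notin\mathrm{CF}(\mathcal{J}_\mathcal{C})\text{ for every }\Gamma\subseteq E_\sigma\}$, and the general relationship graph $G(\mathcal{C})$ is its $1$-skeleton: vertices are the $i\in[n]$ with $\{i\}\in GR(\mathcal{C})$ and edges are the pairs $\{i,j\}\in GR(\mathcal{C})$. The complement of a graph has the same vertex set, with two distinct vertices adjacent iff they are not adjacent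 in the original graph. -}

module Defs where

open import Data.Nat using (ℕ; zero; suc; _<_)
import Data.Nat as ℕ
open import Data.Bool using (Bool; true; false; not; if_then_else_)
open import Data.Fin using (Fin)
open import Data.Fin.Subset using (Subset; _⊆_; _⊂_; ⁅_⁆; _∪_)
open import Data.Vec as Vec using (Vec; replicate; lookup; _[_]≔_)
open import Data.Vec.Properties using (≡-dec)
open import Data.List as List using (List; []; _∷_; _++_; allFin)
open import Data.List.Relation.Unary.All using (All)
import Data.List.Membership.Propositional as L
open import Data.Product using (Σ; ∃; _×_; _,_; proj₁; proj₂)
open import Data.Sum using (_⊎_)
open import Relation.Nullary using (¬_; does)
open import Relation.Binary.PropositionalEquality using (_≡_; _≢_)

Code : ℕ → Set
Code n = List (Subset n)

-- Complete code: codeword containment graph is complete, i.e. any two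
-- distinct codewords are comparable under strict inclusion.
IsCompleteCode : ∀ {n} → Code n → Set
IsCompleteCode C = ∀ σ τ → σ L.∈ C → τ L.∈ C → σ ≢ τ → (σ ⊂ τ) ⊎ (τ ⊂ σ)

-- Polynomials in F₂[x₁,…,xₙ]
-- A monomial is an exponent vector; a polynomial is a list of monomials,
-- the coefficient (in F₂) of a monomial being the parity of its number
-- of occurrences.

Monomial : ℕ → Set
Monomial n = Vec ℕ n

Poly : ℕ → Set
Poly n = List (Monomial n)

coeff : ∀ {n} → Monomial n → Poly n → Bool
coeff m []       = false
coeff m (a ∷ p)  = if does (≡-dec ℕ._≟_ a m) then not (coeff m p) else coeff m p

infix 4 _≈P_
_≈P_ : ∀ {n} → Poly n → Poly n → Set
p ≈P q = ∀ m → coeff m p ≡ coeff m q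

infixl 6 _+P_
_+P_ : ∀ {n} → Poly n → Poly n → Poly n
p +P q = p ++ q

infixl 7 _*P_
_*P_ : ∀ {n} → Poly n → Poly n → Poly n
p *P q = List.concatMap (λ a → List.map (Vec.zipWith ℕ._+_ a) q) p

zeroP : ∀ {n} → Poly n
zeroP = []

oneP : ∀ {n} → Poly n
oneP {n} = replicate n 0 ∷ []

var : ∀ {n} → Fin n → Poly n
var {n} i = (replicate n 0 [ i ]≔ 1) ∷ []

-- 1 - xᵢ  (= 1 + xᵢ over F₂)
oneMinusVar : ∀ {n} → Fin n → Poly n
oneMinusVar i = oneP +P var i

sumP : ∀ {n} → List (Poly n) → Poly n
sumP = List.foldr _+P_ zeroP

prodP : ∀ {n} → List (Poly n) → Poly n
prodP = List.foldr _*P_ oneP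

_∣P_ : ∀ {n} → Poly n → Poly n → Set
g ∣P f = ∃ λ h → f ≈P g *P h

-- Pseudo-monomials  ∏_{i∈σ} xᵢ ∏_{j∈τ} (1 - xⱼ),  σ ∩ τ = ∅.
-- Encoded by assigning to each variable: absent, xᵢ (pos), or 1-xᵢ (neg);
-- disjointness of σ and τ is built in.

data Factor : Set where
  none pos neg : Factor

PseudoMonomial : ℕ → Set
PseudoMonomial n = Vec Factor n

factorPoly : ∀ {n} → Fin n → Factor → Poly n
factorPoly i none = oneP
factorPoly i pos  = var i
factorPoly i neg  = oneMinusVar i

pmPoly : ∀ {n} → PseudoMonomial n → Poly n
pmPoly {n} f = prodP (List.map (λ i → factorPoly i (lookup f i)) (allFin n))

factorDeg : Factor → ℕ
factorDeg none = 0
factorDeg pos  = 1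
factorDeg neg  = 1

pmDeg : ∀ {n} → PseudoMonomial n → ℕ
pmDeg f = Vec.sum (Vec.map factorDeg f)

ρ : ∀ {n} → Subset n → Poly n
ρ v = pmPoly (Vec.map (λ b → if b then pos else neg) v)

InNeuralIdeal : ∀ {n} → Code n → Poly n → Set
InNeuralIdeal {n} C p =
  Σ (List (Poly n × Subset n)) λ gs →
    All (λ gv → ¬ (proj₂ gv L.∈ C)) gs ×
    (p ≈P sumP (List.map (λ gv → proj₁ gv *P ρ (proj₂ gv)) gs))

InCF : ∀ {n} → Code n → Poly n → Set
InCF {n} C p =
  Σ (PseudoMonomial n) λ f →
    (pmPoly f ≈P p) ×
    InNeuralIdeal C (pmPoly f) ×
    (∀ (g : PseudoMonomial n) → InNeuralIdeal C (pmPoly g) →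
       pmDeg g < pmDeg f → ¬ (pmPoly g ∣P pmPoly f))

-- A subset Γ ⊆ E_σ = {xᵢ, 1-xᵢ | i ∈ σ} is given by the set P of i with
-- xᵢ ∈ Γ and the set N of i with 1-xᵢ ∈ Γ (both ⊆ σ).
gammaPoly : ∀ {n} → Subset n → Subset n → Poly n
gammaPoly {n} P N =
  prodP (List.map (λ i → (if lookup P i then var i else oneP)
                         *P (if lookup N i then oneMinusVar i else oneP))
                  (allFin n))

InGR : ∀ {n} → Code n → Subset n → Set
InGR C σ = ∀ P N → P ⊆ σ → N ⊆ σ → ¬ InCF C (gammaPoly P N)

GVertex : ∀ {n} → Code n → Fin n → Set
GVertex C i = InGR C ⁅ i ⁆

GAdj : ∀ {n} → Code n → Fin n → Fin n → Set
GAdj C i j = i ≢ j × InGR C (⁅ i ⁆ ∪ ⁅ j ⁆)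

GComplAdj : ∀ {n} → Code n → Fin n → Fin n → Set
GComplAdj C i j = i ≢ j × ¬ GAdj C i j

IsCompleteGraph : ∀ {n} → (Fin n → Set) → (Fin n → Fin n → Set) → Set
IsCompleteGraph {n} V A = ∀ (i j : Fin n) → V i → V j → i ≢ j → A i j

-- If i ≠ j and {i, j} ∈ GR(C), then no pseudo-monomial in x_i, x_j alone lies in
-- J_C: a minimal one would lie in CF(J_C), and a pseudo-monomial dividing one in
-- x_i, x_j is again in x_i, x_j (evaluate at a point where the multiple is 1 and
-- the divisor 0). On the other hand a pseudo-monomial vanishing on C lies in J_C,
-- being the sum of the ρ_v over its non-zeros v. If x_i(1 - x_j) does not vanish
-- on C, some codeword c has i ∈ c, j ∉ c, and then (1 - x_i)x_j vanishes on C,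
-- since a codeword d with i ∉ d, j ∈ d would be incomparable with c.
--
-- Polynomials are handled through the parities p ↦ ⊕_{a ∈ p} φ a of their
-- monomials, which identify exactly the polynomials with equal coefficients.

module Submission where

open import Defs
open import Algebra.Bundles using (CommutativeRing; CommutativeMonoid)
import Algebra.Properties.CommutativeSemigroup as CommutativeSemigroupProperties
import Data.Bool as Bool
open import Data.Bool using (Bool; true; false; not; if_then_else_; _xor_; _∧_)
open import Data.Bool.Properties
  using (xor-assoc; xor-same; xor-identityʳ; not-injective; ¬-not; ∧-identityʳ; ∧-idem;
         ∧-zeroʳ; ∧-distribˡ-xor; ∧-distribʳ-xor; xor-∧-commutativeRing; ∧-commutativeMonoid)
open import Data.Empty using (⊥; ⊥-elim)
import Data.Fin as Fin
open import Data.Fin using (Fin; zero; suc)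
open import Data.Fin.Subset using (Subset; _∈_; _⊆_; ⁅_⁆; _∪_)
open import Data.Fin.Subset.Properties using (x∈⁅x⁆; x∈p∪q⁺)
open import Data.List as List using (List; []; _∷_; _++_; allFin; tabulate)
open import Data.List.Properties
  using (map-++; map-∘; map-tabulate; tabulate-cong; concat-++; length-removeAt′)
open import Data.List.Relation.Unary.Any using (here; there; index; _─_; any?)
import Data.List.Relation.Unary.All as All
import Data.List.Relation.Unary.All.Properties as All
open import Data.List.Membership.Propositional using (find; lose)
  renaming (_∈_ to _∈ₗ_; _∉_ to _∉ₗ_)
open import Data.List.Membership.Propositional.Properties using (∈-map⁻; ∈-++⁻)
open import Data.Nat as ℕ using (ℕ; zero; suc; _<_)
open import Data.Nat.Induction using (<-wellFounded)
open import Data.Nat.Properties using (+-identityʳ; n<1+n; m<n⇒m<1+n)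
open import Data.Product using (_×_; _,_; proj₁; proj₂)
open import Data.Sum using (_⊎_; inj₁; inj₂; [_,_])
open import Data.Vec as Vec using (Vec; []; _∷_; replicate; lookup; _[_]≔_)
open import Data.Vec.Properties
  using (≡-dec; zipWith-identityˡ; zipWith-identityʳ; lookup-map; []=⇒lookup; lookup⇒[]=;
         lookup∘update; lookup∘update′; lookup-replicate)
open import Function using (_∘_)
open import Induction.WellFounded using (Acc; acc)
open import Relation.Nullary using (¬_; does; yes; no)
open import Relation.Nullary.Decidable using (dec-true)
open import Relation.Binary.PropositionalEquality
  using (_≡_; _≢_; refl; sym; trans; cong; cong₂; subst; module ≡-Reasoning)

private
  module Xor = CommutativeSemigroupProperties
                 (CommutativeRing.+-commutativeSemigroup xor-∧-commutativeRing)
  module And = CommutativeSemigroupProperties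
                 (CommutativeMonoid.commutativeSemigroup ∧-commutativeMonoid)

true≢false : true ≢ false
true≢false ()

xor-cancelˡ : ∀ x y → x xor (x xor y) ≡ y
xor-cancelˡ x y = trans (sym (xor-assoc x x y)) (cong (_xor y) (xor-same x))

xor≡false⇒≡ : ∀ {x y} → x xor y ≡ false → x ≡ y
xor≡false⇒≡ {x} {y} x⊕y≡0 = begin
  x                 ≡⟨ xor-identityʳ x ⟨
  x xor false       ≡⟨ cong (x xor_) x⊕y≡0 ⟨
  x xor (x xor y)   ≡⟨ xor-cancelˡ x y ⟩
  y                 ∎
  where open ≡-Reasoning

infixl 7 _*ᴹ_
_*ᴹ_ : ∀ {n} → Monomial n → Monomial n → Monomial n
_*ᴹ_ = Vec.zipWith ℕ._+_

*ᴹ-identityˡ : ∀ {n} (a : Monomial n) → replicate n 0 *ᴹ a ≡ a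
*ᴹ-identityˡ = zipWith-identityˡ (λ _ → refl)

*ᴹ-identityʳ : ∀ {n} (a : Monomial n) → a *ᴹ replicate n 0 ≡ a
*ᴹ-identityʳ = zipWith-identityʳ +-identityʳ

parity : ∀ {n} → (Monomial n → Bool) → Poly n → Bool
parity φ []      = false
parity φ (a ∷ p) = φ a xor parity φ p

parity-cong : ∀ {n} {φ ψ : Monomial n → Bool} → (∀ a → φ a ≡ ψ a) →
              ∀ p → parity φ p ≡ parity ψ p
parity-cong φ≗ψ []      = refl
parity-cong φ≗ψ (a ∷ p) = cong₂ _xor_ (φ≗ψ a) (parity-cong φ≗ψ p)

parity-++ : ∀ {n} (φ : Monomial n → Bool) p q →
            parity φ (p ++ q) ≡ parity φ p xor parity φ q
parity-++ φ []      q = refl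
parity-++ φ (a ∷ p) q = trans (cong (φ a xor_) (parity-++ φ p q)) (sym (xor-assoc (φ a) _ _))

parity-map : ∀ {m n} (φ : Monomial n → Bool) (f : Monomial m → Monomial n) p →
             parity φ (List.map f p) ≡ parity (φ ∘ f) p
parity-map φ f []      = refl
parity-map φ f (a ∷ p) = cong (φ (f a) xor_) (parity-map φ f p)

parity-*P : ∀ {n} (φ : Monomial n → Bool) p q →
            parity φ (p *P q) ≡ parity (λ a → parity (λ b → φ (a *ᴹ b)) q) p
parity-*P φ []      q = refl
parity-*P φ (a ∷ p) q = begin
  parity φ (List.map (a *ᴹ_) q ++ p *P q)
    ≡⟨ parity-++ φ (List.map (a *ᴹ_) q) (p *P q) ⟩
  parity φ (List.map (a *ᴹ_) q) xor parity φ (p *P q)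
    ≡⟨ cong₂ _xor_ (parity-map φ (a *ᴹ_) q) (parity-*P φ p q) ⟩
  parity (λ b → φ (a *ᴹ b)) q xor parity (λ a → parity (λ b → φ (a *ᴹ b)) q) p
    ∎
  where open ≡-Reasoning

parity-∧ˡ : ∀ {n} c (φ : Monomial n → Bool) p → parity (λ a → c ∧ φ a) p ≡ c ∧ parity φ p
parity-∧ˡ c φ []      = sym (∧-zeroʳ c)
parity-∧ˡ c φ (a ∷ p) =
  trans (cong ((c ∧ φ a) xor_) (parity-∧ˡ c φ p)) (sym (∧-distribˡ-xor c (φ a) _))

parity-∧ʳ : ∀ {n} c (φ : Monomial n → Bool) p → parity (λ a → φ a ∧ c) p ≡ parity φ p ∧ c
parity-∧ʳ c φ []      = refl
parity-∧ʳ c φ (a ∷ p) =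
  trans (cong ((φ a ∧ c) xor_) (parity-∧ʳ c φ p)) (sym (∧-distribʳ-xor c (φ a) _))

parity-─ : ∀ {n} (φ : Monomial n → Bool) {a p} (a∈p : a ∈ₗ p) →
           parity φ p ≡ φ a xor parity φ (p ─ a∈p)
parity-─ φ (here refl)             = refl
parity-─ φ {a} {b ∷ p} (there a∈p) =
  trans (cong (φ b xor_) (parity-─ φ a∈p)) (Xor.x∙yz≈y∙xz (φ b) (φ a) (parity φ (p ─ a∈p)))

_==ᴹ_ : ∀ {n} → Monomial n → Monomial n → Bool
a ==ᴹ b = does (≡-dec ℕ._≟_ a b)

coeff≡parity : ∀ {n} (m : Monomial n) p → coeff m p ≡ parity (_==ᴹ m) p
coeff≡parity m []      = refl
coeff≡parity m (a ∷ p) with a ==ᴹ m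
... | true  = cong not (coeff≡parity m p)
... | false = coeff≡parity m p

coeff-∷-self : ∀ {n} (a : Monomial n) p → coeff a (a ∷ p) ≡ not (coeff a p)
coeff-∷-self a p rewrite dec-true (≡-dec ℕ._≟_ a a) refl = refl

coeff≡true⇒∈ : ∀ {n} {m : Monomial n} p → coeff m p ≡ true → m ∈ₗ p
coeff≡true⇒∈ {m = m} (a ∷ p) c with ≡-dec ℕ._≟_ a m
... | yes refl = here refl
... | no _     = there (coeff≡true⇒∈ p c)

infix 4 _≐_
_≐_ : ∀ {n} → Poly n → Poly n → Set
p ≐ q = ∀ φ → parity φ p ≡ parity φ q

≐⇒≈P : ∀ {n} {p q : Poly n} → p ≐ q → p ≈P q
≐⇒≈P {p = p} {q} p≐q m =
  trans (coeff≡parity m p) (trans (p≐q (_==ᴹ m)) (sym (coeff≡parity m q)))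

-- All coefficients being even, the head monomial occurs again in the tail,
-- and cancelling the two occurrences leaves a shorter list of the same kind.
parity-vanishes : ∀ {n} (p : Poly n) → Acc _<_ (List.length p) →
                  (∀ m → coeff m p ≡ false) → ∀ φ → parity φ p ≡ false
parity-vanishes []      _        _        φ = refl
parity-vanishes (a ∷ p) (acc rs) coeffs≡0 φ =
  trans (cancel φ) (parity-vanishes (p ─ a∈p) (rs shorter) coeffs′≡0 φ)
  where
  a∈p : a ∈ₗ p
  a∈p = coeff≡true⇒∈ p (not-injective (trans (sym (coeff-∷-self a p)) (coeffs≡0 a)))
  cancel : ∀ ψ → parity ψ (a ∷ p) ≡ parity ψ (p ─ a∈p)
  cancel ψ = trans (cong (ψ a xor_) (parity-─ ψ a∈p)) (xor-cancelˡ (ψ a) _)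
  coeffs′≡0 : ∀ m → coeff m (p ─ a∈p) ≡ false
  coeffs′≡0 m = begin
    coeff m (p ─ a∈p)           ≡⟨ coeff≡parity m (p ─ a∈p) ⟩
    parity (_==ᴹ m) (p ─ a∈p)   ≡⟨ cancel (_==ᴹ m) ⟨
    parity (_==ᴹ m) (a ∷ p)     ≡⟨ coeff≡parity m (a ∷ p) ⟨
    coeff m (a ∷ p)             ≡⟨ coeffs≡0 m ⟩
    false                       ∎
    where open ≡-Reasoning
  shorter : List.length (p ─ a∈p) < suc (List.length p)
  shorter rewrite length-removeAt′ p (index a∈p) = m<n⇒m<1+n (n<1+n _)

≈P⇒≐ : ∀ {n} {p q : Poly n} → p ≈P q → p ≐ q
≈P⇒≐ {p = p} {q} p≈q φ = xor≡false⇒≡ (begin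
  parity φ p xor parity φ q   ≡⟨ parity-++ φ p q ⟨
  parity φ (p ++ q)           ≡⟨ parity-vanishes (p ++ q) (<-wellFounded _) coeffs≡0 φ ⟩
  false                       ∎)
  where
  open ≡-Reasoning
  coeffs≡0 : ∀ m → coeff m (p ++ q) ≡ false
  coeffs≡0 m = begin
    coeff m (p ++ q)                            ≡⟨ coeff≡parity m (p ++ q) ⟩
    parity (_==ᴹ m) (p ++ q)                    ≡⟨ parity-++ (_==ᴹ m) p q ⟩
    parity (_==ᴹ m) p xor parity (_==ᴹ m) q     ≡⟨ cong₂ _xor_ (coeff≡parity m p) (coeff≡parity m q) ⟨
    coeff m p xor coeff m q                     ≡⟨ cong (_xor coeff m q) (p≈q m) ⟩
    coeff m q xor coeff m q                     ≡⟨ xor-same (coeff m q) ⟩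
    false                                       ∎

*P-cong : ∀ {n} {p p′ q q′ : Poly n} → p ≐ p′ → q ≐ q′ → p *P q ≐ p′ *P q′
*P-cong {p = p} {p′} {q} {q′} p≐p′ q≐q′ φ = begin
  parity φ (p *P q)                                ≡⟨ parity-*P φ p q ⟩
  parity (λ a → parity (λ b → φ (a *ᴹ b)) q) p     ≡⟨ parity-cong (λ a → q≐q′ (λ b → φ (a *ᴹ b))) p ⟩
  parity (λ a → parity (λ b → φ (a *ᴹ b)) q′) p    ≡⟨ p≐p′ _ ⟩
  parity (λ a → parity (λ b → φ (a *ᴹ b)) q′) p′   ≡⟨ parity-*P φ p′ q′ ⟨
  parity φ (p′ *P q′)                              ∎
  where open ≡-Reasoning

*P-identityˡ : ∀ {n} (q : Poly n) → oneP *P q ≐ q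
*P-identityˡ q φ =
  trans (parity-*P φ oneP q) (trans (xor-identityʳ _) (parity-cong (cong φ ∘ *ᴹ-identityˡ) q))

*P-identityʳ : ∀ {n} (p : Poly n) → p *P oneP ≐ p
*P-identityʳ p φ = trans (parity-*P φ p oneP)
  (parity-cong (λ a → trans (xor-identityʳ _) (cong φ (*ᴹ-identityʳ a))) p)

sumP-map-cong : ∀ {A : Set} {n} {F G : A → Poly n} → (∀ x → F x ≐ G x) →
                ∀ xs → sumP (List.map F xs) ≐ sumP (List.map G xs)
sumP-map-cong F≐G []       φ = refl
sumP-map-cong {F = F} {G} F≐G (x ∷ xs) φ = begin
  parity φ (F x ++ sumP (List.map F xs))               ≡⟨ parity-++ φ (F x) _ ⟩
  parity φ (F x) xor parity φ (sumP (List.map F xs))   ≡⟨ cong₂ _xor_ (F≐G x φ) (sumP-map-cong F≐G xs φ) ⟩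
  parity φ (G x) xor parity φ (sumP (List.map G xs))   ≡⟨ parity-++ φ (G x) _ ⟨
  parity φ (G x ++ sumP (List.map G xs))               ∎
  where open ≡-Reasoning

prodP-map-cong : ∀ {A : Set} {n} {F G : A → Poly n} → (∀ x → F x ≐ G x) →
                 ∀ xs → prodP (List.map F xs) ≐ prodP (List.map G xs)
prodP-map-cong F≐G []       φ = refl
prodP-map-cong {F = F} {G} F≐G (x ∷ xs) =
  *P-cong {p = F x} {G x} {prodP (List.map F xs)} {prodP (List.map G xs)}
          (F≐G x) (prodP-map-cong F≐G xs)

lift : ∀ {n} → Poly n → Poly (suc n)
lift = List.map (0 ∷_)

lift-*P : ∀ {n} (p q : Poly n) → lift (p *P q) ≡ lift p *P lift q
lift-*P []      q = refl
lift-*P (a ∷ p) q = begin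
  lift (List.map (a *ᴹ_) q ++ p *P q)
    ≡⟨ map-++ (0 ∷_) (List.map (a *ᴹ_) q) (p *P q) ⟩
  lift (List.map (a *ᴹ_) q) ++ lift (p *P q)
    ≡⟨ cong₂ _++_ (trans (sym (map-∘ q)) (map-∘ q)) (lift-*P p q) ⟩
  List.map ((0 ∷ a) *ᴹ_) (lift q) ++ lift p *P lift q
    ∎
  where open ≡-Reasoning

lift-prodP : ∀ {n} (ps : List (Poly n)) → lift (prodP ps) ≡ prodP (List.map lift ps)
lift-prodP []       = refl
lift-prodP (p ∷ ps) = trans (lift-*P p (prodP ps)) (cong (lift p *P_) (lift-prodP ps))

factorPoly-suc : ∀ {n} (i : Fin n) y → factorPoly (suc i) y ≡ lift (factorPoly i y)
factorPoly-suc i none = refl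
factorPoly-suc i pos  = refl
factorPoly-suc i neg  = refl

pmPoly-∷ : ∀ {n} y (f : PseudoMonomial n) →
           pmPoly (y ∷ f) ≡ factorPoly zero y *P lift (pmPoly f)
pmPoly-∷ {n} y f = cong (factorPoly zero y *P_) (sym (begin
  lift (prodP (List.map factor (allFin n)))            ≡⟨ lift-prodP (List.map factor (allFin n)) ⟩
  prodP (List.map lift (List.map factor (allFin n)))   ≡⟨ cong prodP (map-∘ (allFin n)) ⟨
  prodP (List.map (lift ∘ factor) (allFin n))          ≡⟨ cong prodP (map-tabulate (λ i → i) (lift ∘ factor)) ⟩
  prodP (tabulate (lift ∘ factor))                     ≡⟨ cong prodP (tabulate-cong (λ i → factorPoly-suc i (lookup f i))) ⟨
  prodP (tabulate (factor′ ∘ suc))                     ≡⟨ cong prodP (map-tabulate suc factor′) ⟨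
  prodP (List.map factor′ (tabulate suc))              ∎))
  where
  open ≡-Reasoning
  factor : Fin n → Poly n
  factor i = factorPoly i (lookup f i)
  factor′ : Fin (suc n) → Poly (suc n)
  factor′ i = factorPoly i (lookup (y ∷ f) i)

-- The parity of (factor y in the first variable) * r against φ, where χ e is
-- the parity of r against the monomials with first exponent e.
factorParity : Factor → (ℕ → Bool) → Bool
factorParity none χ = χ 0
factorParity pos  χ = χ 1
factorParity neg  χ = χ 0 xor χ 1

factorParity-cong : ∀ y {χ χ′ : ℕ → Bool} → (∀ e → χ e ≡ χ′ e) →
                    factorParity y χ ≡ factorParity y χ′
factorParity-cong none χ≗χ′ = χ≗χ′ 0
factorParity-cong pos  χ≗χ′ = χ≗χ′ 1
factorParity-cong neg  χ≗χ′ = cong₂ _xor_ (χ≗χ′ 0) (χ≗χ′ 1)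

factorParity-xor : ∀ y (χ χ′ : ℕ → Bool) →
                   factorParity y (λ e → χ e xor χ′ e) ≡ factorParity y χ xor factorParity y χ′
factorParity-xor none χ χ′ = refl
factorParity-xor pos  χ χ′ = refl
factorParity-xor neg  χ χ′ = Xor.interchange (χ 0) (χ′ 0) (χ 1) (χ′ 1)

factorParity-none : ∀ χ → factorParity none χ ≡ factorParity pos χ xor factorParity neg χ
factorParity-none χ = sym (begin
  χ 1 xor (χ 0 xor χ 1)   ≡⟨ Xor.x∙yz≈y∙xz (χ 1) (χ 0) (χ 1) ⟩
  χ 0 xor (χ 1 xor χ 1)   ≡⟨ cong (χ 0 xor_) (xor-same (χ 1)) ⟩
  χ 0 xor false           ≡⟨ xor-identityʳ (χ 0) ⟩
  χ 0                     ∎)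
  where open ≡-Reasoning

parity-pmPoly-∷ : ∀ {n} y (f : PseudoMonomial n) φ →
                  parity φ (pmPoly (y ∷ f)) ≡ factorParity y (λ e → parity (φ ∘ (e ∷_)) (pmPoly f))
parity-pmPoly-∷ {n} y f φ = begin
  parity φ (pmPoly (y ∷ f))                         ≡⟨ cong (parity φ) (pmPoly-∷ y f) ⟩
  parity φ (factorPoly zero y *P lift (pmPoly f))   ≡⟨ parity-*P φ (factorPoly zero y) _ ⟩
  parity φ₁ (factorPoly zero y)                     ≡⟨ byFactor y ⟩
  factorParity y χ                                  ∎
  where
  open ≡-Reasoning
  φ₁ : Monomial (suc n) → Bool
  φ₁ a = parity (λ b → φ (a *ᴹ b)) (lift (pmPoly f))
  χ : ℕ → Bool
  χ e = parity (φ ∘ (e ∷_)) (pmPoly f)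
  φ₁-power : ∀ e → φ₁ (e ∷ replicate n 0) ≡ χ e
  φ₁-power e = trans (parity-map _ (0 ∷_) (pmPoly f))
    (parity-cong (λ b → cong φ (cong₂ _∷_ (+-identityʳ e) (*ᴹ-identityˡ b))) (pmPoly f))
  byFactor : ∀ y → parity φ₁ (factorPoly zero y) ≡ factorParity y χ
  byFactor none = trans (xor-identityʳ _) (φ₁-power 0)
  byFactor pos  = trans (xor-identityʳ _) (φ₁-power 1)
  byFactor neg  = cong₂ _xor_ (φ₁-power 0) (trans (xor-identityʳ _) (φ₁-power 1))

_^ᵇ_ : Bool → ℕ → Bool
b ^ᵇ zero  = true
b ^ᵇ suc _ = b

^ᵇ-+ : ∀ b e e′ → b ^ᵇ (e ℕ.+ e′) ≡ b ^ᵇ e ∧ b ^ᵇ e′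
^ᵇ-+ b zero    e′      = refl
^ᵇ-+ b (suc e) zero    = sym (∧-identityʳ b)
^ᵇ-+ b (suc e) (suc _) = sym (∧-idem b)

evalMonomial : ∀ {n} → Vec Bool n → Monomial n → Bool
evalMonomial []      []      = true
evalMonomial (b ∷ x) (e ∷ a) = b ^ᵇ e ∧ evalMonomial x a

evalMonomial-*ᴹ : ∀ {n} (x : Vec Bool n) a c →
                  evalMonomial x (a *ᴹ c) ≡ evalMonomial x a ∧ evalMonomial x c
evalMonomial-*ᴹ []      []      []       = refl
evalMonomial-*ᴹ (b ∷ x) (e ∷ a) (e′ ∷ c) =
  trans (cong₂ _∧_ (^ᵇ-+ b e e′) (evalMonomial-*ᴹ x a c)) (And.interchange (b ^ᵇ e) _ _ _)

eval : ∀ {n} → Vec Bool n → Poly n → Bool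
eval x = parity (evalMonomial x)

eval-*P : ∀ {n} (x : Vec Bool n) p q → eval x (p *P q) ≡ eval x p ∧ eval x q
eval-*P x p q = begin
  eval x (p *P q)
    ≡⟨ parity-*P (evalMonomial x) p q ⟩
  parity (λ a → parity (λ c → evalMonomial x (a *ᴹ c)) q) p
    ≡⟨ parity-cong (λ a → parity-cong (evalMonomial-*ᴹ x a) q) p ⟩
  parity (λ a → parity (λ c → evalMonomial x a ∧ evalMonomial x c) q) p
    ≡⟨ parity-cong (λ a → parity-∧ˡ (evalMonomial x a) (evalMonomial x) q) p ⟩
  parity (λ a → evalMonomial x a ∧ eval x q) p
    ≡⟨ parity-∧ʳ (eval x q) (evalMonomial x) p ⟩
  eval x p ∧ eval x q
    ∎
  where open ≡-Reasoning

factorValue : Factor → Bool → Bool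
factorValue none _ = true
factorValue pos  b = b
factorValue neg  b = not b

pmValue : ∀ {n} → PseudoMonomial n → Vec Bool n → Bool
pmValue []      []      = true
pmValue (y ∷ f) (b ∷ x) = factorValue y b ∧ pmValue f x

factorParity-^ᵇ : ∀ y b t → factorParity y (λ e → b ^ᵇ e ∧ t) ≡ factorValue y b ∧ t
factorParity-^ᵇ none b     t = refl
factorParity-^ᵇ pos  b     t = refl
factorParity-^ᵇ neg  true  t = xor-same t
factorParity-^ᵇ neg  false t = xor-identityʳ t

eval-pmPoly : ∀ {n} (f : PseudoMonomial n) x → eval x (pmPoly f) ≡ pmValue f x
eval-pmPoly []      []      = refl
eval-pmPoly (y ∷ f) (b ∷ x) = begin
  eval (b ∷ x) (pmPoly (y ∷ f))
    ≡⟨ parity-pmPoly-∷ y f (evalMonomial (b ∷ x)) ⟩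
  factorParity y (λ e → parity (λ a → b ^ᵇ e ∧ evalMonomial x a) (pmPoly f))
    ≡⟨ factorParity-cong y (λ e → parity-∧ˡ (b ^ᵇ e) (evalMonomial x) (pmPoly f)) ⟩
  factorParity y (λ e → b ^ᵇ e ∧ eval x (pmPoly f))
    ≡⟨ factorParity-^ᵇ y b (eval x (pmPoly f)) ⟩
  factorValue y b ∧ eval x (pmPoly f)
    ≡⟨ cong (factorValue y b ∧_) (eval-pmPoly f x) ⟩
  factorValue y b ∧ pmValue f x
    ∎
  where open ≡-Reasoning

pmValue≡true⇒factorValue≡true : ∀ {n} (f : PseudoMonomial n) x → pmValue f x ≡ true →
                                ∀ k → factorValue (lookup f k) (lookup x k) ≡ true
pmValue≡true⇒factorValue≡true (y ∷ f) (b ∷ x) f[x]≡1 k with factorValue y b in y[b]≡1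
pmValue≡true⇒factorValue≡true (y ∷ f) (b ∷ x) f[x]≡1 zero    | true = y[b]≡1
pmValue≡true⇒factorValue≡true (y ∷ f) (b ∷ x) f[x]≡1 (suc k) | true =
  pmValue≡true⇒factorValue≡true f x f[x]≡1 k

nonZeros : ∀ {n} → PseudoMonomial n → List (Subset n)
nonZeros []         = [] ∷ []
nonZeros (none ∷ f) = List.map (true ∷_) (nonZeros f) ++ List.map (false ∷_) (nonZeros f)
nonZeros (pos ∷ f)  = List.map (true ∷_) (nonZeros f)
nonZeros (neg ∷ f)  = List.map (false ∷_) (nonZeros f)

∈nonZeros⇒pmValue≡true : ∀ {n} (f : PseudoMonomial n) {v} → v ∈ₗ nonZeros f → pmValue f v ≡ true
∈nonZeros⇒pmValue≡true []         (here refl) = refl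
∈nonZeros⇒pmValue≡true (none ∷ f) v∈ with ∈-++⁻ (List.map (true ∷_) (nonZeros f)) v∈
... | inj₁ v∈₁ with ∈-map⁻ (true ∷_) v∈₁
...   | _ , w∈ , refl = ∈nonZeros⇒pmValue≡true f w∈
∈nonZeros⇒pmValue≡true (none ∷ f) v∈ | inj₂ v∈₂ with ∈-map⁻ (false ∷_) v∈₂
...   | _ , w∈ , refl = ∈nonZeros⇒pmValue≡true f w∈
∈nonZeros⇒pmValue≡true (pos ∷ f)  v∈ with ∈-map⁻ (true ∷_) v∈
... | _ , w∈ , refl = ∈nonZeros⇒pmValue≡true f w∈
∈nonZeros⇒pmValue≡true (neg ∷ f)  v∈ with ∈-map⁻ (false ∷_) v∈
... | _ , w∈ , refl = ∈nonZeros⇒pmValue≡true f w∈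

ρSum : ∀ {n} → List (Subset n) → Poly n
ρSum vs = sumP (List.map ρ vs)

ρSum-++ : ∀ {n} (us vs : List (Subset n)) → ρSum (us ++ vs) ≡ ρSum us ++ ρSum vs
ρSum-++ us vs = trans (cong sumP (map-++ ρ us vs)) (sym (concat-++ (List.map ρ us) (List.map ρ vs)))

parity-ρSum-∷ : ∀ {n} b (vs : List (Subset n)) φ →
                parity φ (ρSum (List.map (b ∷_) vs))
                  ≡ factorParity (if b then pos else neg) (λ e → parity (φ ∘ (e ∷_)) (ρSum vs))
parity-ρSum-∷ true  []       φ = refl
parity-ρSum-∷ false []       φ = refl
parity-ρSum-∷ b     (v ∷ vs) φ = begin
  parity φ (ρ (b ∷ v) ++ ρSum (List.map (b ∷_) vs))
    ≡⟨ parity-++ φ (ρ (b ∷ v)) _ ⟩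
  parity φ (ρ (b ∷ v)) xor parity φ (ρSum (List.map (b ∷_) vs))
    ≡⟨ cong₂ _xor_ (parity-pmPoly-∷ y _ φ) (parity-ρSum-∷ b vs φ) ⟩
  factorParity y (χ (ρ v)) xor factorParity y (χ (ρSum vs))
    ≡⟨ factorParity-xor y (χ (ρ v)) (χ (ρSum vs)) ⟨
  factorParity y (λ e → χ (ρ v) e xor χ (ρSum vs) e)
    ≡⟨ factorParity-cong y (λ e → parity-++ (φ ∘ (e ∷_)) (ρ v) _) ⟨
  factorParity y (χ (ρ v ++ ρSum vs))
    ∎
  where
  open ≡-Reasoning
  y : Factor
  y = if b then pos else neg
  χ : Poly _ → ℕ → Bool
  χ p e = parity (φ ∘ (e ∷_)) p

parity-ρSum-nonZeros-∷ : ∀ {n} y (f : PseudoMonomial n) φ →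
                         parity φ (ρSum (nonZeros (y ∷ f)))
                           ≡ factorParity y (λ e → parity (φ ∘ (e ∷_)) (ρSum (nonZeros f)))
parity-ρSum-nonZeros-∷ none f φ = begin
  parity φ (ρSum (ts ++ fs))                      ≡⟨ cong (parity φ) (ρSum-++ ts fs) ⟩
  parity φ (ρSum ts ++ ρSum fs)                   ≡⟨ parity-++ φ (ρSum ts) (ρSum fs) ⟩
  parity φ (ρSum ts) xor parity φ (ρSum fs)       ≡⟨ cong₂ _xor_ (parity-ρSum-∷ true vs φ) (parity-ρSum-∷ false vs φ) ⟩
  factorParity pos χ xor factorParity neg χ       ≡⟨ factorParity-none χ ⟨
  factorParity none χ                             ∎
  where
  open ≡-Reasoning
  vs ts fs : List (Subset _)
  vs = nonZeros f
  ts = List.map (true ∷_) vs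
  fs = List.map (false ∷_) vs
  χ : ℕ → Bool
  χ e = parity (φ ∘ (e ∷_)) (ρSum vs)
parity-ρSum-nonZeros-∷ pos f φ = parity-ρSum-∷ true (nonZeros f) φ
parity-ρSum-nonZeros-∷ neg f φ = parity-ρSum-∷ false (nonZeros f) φ

pmPoly≐ρSum-nonZeros : ∀ {n} (f : PseudoMonomial n) → pmPoly f ≐ ρSum (nonZeros f)
pmPoly≐ρSum-nonZeros []      φ = refl
pmPoly≐ρSum-nonZeros (y ∷ f) φ = begin
  parity φ (pmPoly (y ∷ f))
    ≡⟨ parity-pmPoly-∷ y f φ ⟩
  factorParity y (λ e → parity (φ ∘ (e ∷_)) (pmPoly f))
    ≡⟨ factorParity-cong y (λ e → pmPoly≐ρSum-nonZeros f (φ ∘ (e ∷_))) ⟩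
  factorParity y (λ e → parity (φ ∘ (e ∷_)) (ρSum (nonZeros f)))
    ≡⟨ parity-ρSum-nonZeros-∷ y f φ ⟨
  parity φ (ρSum (nonZeros (y ∷ f)))
    ∎
  where open ≡-Reasoning

vanishing⇒pmPoly∈ideal : ∀ {n} (C : Code n) (f : PseudoMonomial n) →
                         (∀ {c} → c ∈ₗ C → pmValue f c ≡ false) → InNeuralIdeal C (pmPoly f)
vanishing⇒pmPoly∈ideal C f vanishes =
  gs , All.map⁺ (All.tabulate notCodeword) , ≐⇒≈P {p = pmPoly f} {q = sum} pmPoly≐sum
  where
  notCodeword : ∀ {v} → v ∈ₗ nonZeros f → v ∉ₗ C
  notCodeword v∈ v∈C = true≢false (trans (sym (∈nonZeros⇒pmValue≡true f v∈)) (vanishes v∈C))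
  gs : List (Poly _ × Subset _)
  gs = List.map (oneP ,_) (nonZeros f)
  sum : Poly _
  sum = sumP (List.map (λ gv → proj₁ gv *P ρ (proj₂ gv)) gs)
  pmPoly≐sum : pmPoly f ≐ sum
  pmPoly≐sum φ = begin
    parity φ (pmPoly f)
      ≡⟨ pmPoly≐ρSum-nonZeros f φ ⟩
    parity φ (ρSum (nonZeros f))
      ≡⟨ sumP-map-cong (λ v ψ → sym (*P-identityˡ (ρ v) ψ)) (nonZeros f) φ ⟩
    parity φ (sumP (List.map (λ v → oneP *P ρ v) (nonZeros f)))
      ≡⟨ cong (parity φ ∘ sumP) (map-∘ (nonZeros f)) ⟩
    parity φ sum
      ∎
    where open ≡-Reasoning

-- A point at which f does not vanish but g does, wherever g has a factor that f lacks.
separating : Factor → Factor → Bool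
separating pos  _   = true
separating neg  _   = false
separating none pos = false
separating none _   = true

pmValue-separatingˡ : ∀ {n} (f g : PseudoMonomial n) →
                      pmValue f (Vec.zipWith separating f g) ≡ true
pmValue-separatingˡ []         []      = refl
pmValue-separatingˡ (none ∷ f) (_ ∷ g) = pmValue-separatingˡ f g
pmValue-separatingˡ (pos ∷ f)  (_ ∷ g) = pmValue-separatingˡ f g
pmValue-separatingˡ (neg ∷ f)  (_ ∷ g) = pmValue-separatingˡ f g

pmValue-separatingʳ : ∀ {n} (f g : PseudoMonomial n) k → lookup f k ≡ none → lookup g k ≢ none →
                      pmValue g (Vec.zipWith separating f g) ≡ false
pmValue-separatingʳ (none ∷ f) (none ∷ g) zero    _       gₖ≢none = ⊥-elim (gₖ≢none refl)
pmValue-separatingʳ (none ∷ f) (pos ∷ g)  zero    _       _       = refl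
pmValue-separatingʳ (none ∷ f) (neg ∷ g)  zero    _       _       = refl
pmValue-separatingʳ (y ∷ f)    (z ∷ g)    (suc k) fₖ≡none gₖ≢none = trans
  (cong (factorValue z (separating y z) ∧_) (pmValue-separatingʳ f g k fₖ≡none gₖ≢none))
  (∧-zeroʳ _)

∣P⇒support-⊆ : ∀ {n} (f g : PseudoMonomial n) → pmPoly g ∣P pmPoly f →
               ∀ k → lookup g k ≢ none → lookup f k ≢ none
∣P⇒support-⊆ f g (h , f≈gh) k gₖ≢none fₖ≡none = true≢false (begin
  true                           ≡⟨ pmValue-separatingˡ f g ⟨
  pmValue f x                    ≡⟨ eval-pmPoly f x ⟨
  eval x (pmPoly f)              ≡⟨ ≈P⇒≐ {p = pmPoly f} {q = pmPoly g *P h} f≈gh (evalMonomial x) ⟩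
  eval x (pmPoly g *P h)         ≡⟨ eval-*P x (pmPoly g) h ⟩
  eval x (pmPoly g) ∧ eval x h   ≡⟨ cong (_∧ eval x h) (eval-pmPoly g x) ⟩
  pmValue g x ∧ eval x h         ≡⟨ cong (_∧ eval x h) (pmValue-separatingʳ f g k fₖ≡none gₖ≢none) ⟩
  false                          ∎)
  where
  open ≡-Reasoning
  x : Vec Bool _
  x = Vec.zipWith separating f g

isPos isNeg : Factor → Bool
isPos pos = true
isPos _   = false
isNeg neg = true
isNeg _   = false

positives negatives : ∀ {n} → PseudoMonomial n → Subset n
positives = Vec.map isPos
negatives = Vec.map isNeg

pmPoly≈gammaPoly : ∀ {n} (f : PseudoMonomial n) → pmPoly f ≈P gammaPoly (positives f) (negatives f)
pmPoly≈gammaPoly {n} f =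
  ≐⇒≈P {p = pmPoly f} {q = gammaPoly (positives f) (negatives f)} (prodP-map-cong atIndex (allFin n))
  where
  factorPoly≐ : ∀ i y → factorPoly i y ≐
                  (if isPos y then var i else oneP) *P (if isNeg y then oneMinusVar i else oneP)
  factorPoly≐ i none φ = sym (*P-identityˡ oneP φ)
  factorPoly≐ i pos  φ = sym (*P-identityʳ (var i) φ)
  factorPoly≐ i neg  φ = sym (*P-identityˡ (oneMinusVar i) φ)
  atIndex : ∀ i → factorPoly i (lookup f i) ≐
                    (if lookup (positives f) i then var i else oneP)
                    *P (if lookup (negatives f) i then oneMinusVar i else oneP)
  atIndex i rewrite lookup-map i isPos f | lookup-map i isNeg f = factorPoly≐ i (lookup f i)

SupportedIn : ∀ {n} → PseudoMonomial n → Subset n → Set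
SupportedIn f σ = ∀ k → lookup f k ≢ none → k ∈ σ

supportedIn⇒map⊆ : ∀ {n} {f : PseudoMonomial n} {σ} (p : Factor → Bool) → p none ≡ false →
                   SupportedIn f σ → Vec.map p f ⊆ σ
supportedIn⇒map⊆ {f = f} p p-none f⊆σ {k} k∈ = f⊆σ k λ fₖ≡none → true≢false (begin
  true                      ≡⟨ []=⇒lookup k∈ ⟨
  lookup (Vec.map p f) k    ≡⟨ lookup-map k p f ⟩
  p (lookup f k)            ≡⟨ cong p fₖ≡none ⟩
  p none                    ≡⟨ p-none ⟩
  false                     ∎)
  where open ≡-Reasoning

-- A pseudo-monomial of J_C supported in σ is either minimal, hence a
-- product of elements of E_σ lying in CF(J_C), or divisible by one of
-- smaller degree, which is again supported in σ.
InGR⇒pmPoly∉ideal : ∀ {n} {C : Code n} {σ} → InGR C σ →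
                    ∀ f → SupportedIn f σ → ¬ InNeuralIdeal C (pmPoly f)
InGR⇒pmPoly∉ideal {C = C} {σ} σ∈GR f = go f (<-wellFounded (pmDeg f))
  where
  go : ∀ f → Acc _<_ (pmDeg f) → SupportedIn f σ → ¬ InNeuralIdeal C (pmPoly f)
  go f (acc smaller) f⊆σ f∈J =
    σ∈GR (positives f) (negatives f)
         (supportedIn⇒map⊆ isPos refl f⊆σ) (supportedIn⇒map⊆ isNeg refl f⊆σ)
         (f , pmPoly≈gammaPoly f , f∈J , minimal)
    where
    minimal : ∀ g → InNeuralIdeal C (pmPoly g) → pmDeg g < pmDeg f → ¬ pmPoly g ∣P pmPoly f
    minimal g g∈J g<f g∣f =
      go g (smaller g<f) (λ k gₖ≢none → f⊆σ k (∣P⇒support-⊆ f g g∣f k gₖ≢none)) g∈J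

pmPair : ∀ {n} → Fin n → Factor → Fin n → Factor → PseudoMonomial n
pmPair {n} i a j b = replicate n none [ i ]≔ a [ j ]≔ b

lookup-pmPairˡ : ∀ {n} {i j : Fin n} → i ≢ j → ∀ a b → lookup (pmPair i a j b) i ≡ a
lookup-pmPairˡ {n} {i} i≢j a b =
  trans (lookup∘update′ i≢j (replicate n none [ i ]≔ a) b) (lookup∘update i (replicate n none) a)

lookup-pmPairʳ : ∀ {n} (i j : Fin n) a b → lookup (pmPair i a j b) j ≡ b
lookup-pmPairʳ {n} i j a b = lookup∘update j (replicate n none [ i ]≔ a) b

pmPair-supported : ∀ {n} (i j : Fin n) a b → SupportedIn (pmPair i a j b) (⁅ i ⁆ ∪ ⁅ j ⁆)
pmPair-supported {n} i j a b k kth≢none with k Fin.≟ j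
... | yes refl = x∈p∪q⁺ {p = ⁅ i ⁆} (inj₂ (x∈⁅x⁆ k))
... | no k≢j with k Fin.≟ i
...   | yes refl = x∈p∪q⁺ {q = ⁅ j ⁆} (inj₁ (x∈⁅x⁆ k))
...   | no k≢i = ⊥-elim (kth≢none (begin
  lookup (pmPair i a j b) k              ≡⟨ lookup∘update′ k≢j (replicate n none [ i ]≔ a) b ⟩
  lookup (replicate n none [ i ]≔ a) k   ≡⟨ lookup∘update′ k≢i (replicate n none) a ⟩
  lookup (replicate n none) k            ≡⟨ lookup-replicate k none ⟩
  none                                   ∎))
  where open ≡-Reasoning

pmValue-pmPair : ∀ {n} {i j : Fin n} → i ≢ j → ∀ a b x → pmValue (pmPair i a j b) x ≡ true →
                 factorValue a (lookup x i) ≡ true × factorValue b (lookup x j) ≡ true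
pmValue-pmPair {i = i} {j} i≢j a b x f[x]≡1 =
  subst (λ y → factorValue y (lookup x i) ≡ true) (lookup-pmPairˡ i≢j a b) (atIndex i) ,
  subst (λ y → factorValue y (lookup x j) ≡ true) (lookup-pmPairʳ i j a b) (atIndex j)
  where
  atIndex = pmValue≡true⇒factorValue≡true (pmPair i a j b) x f[x]≡1

complete⇒¬opposite : ∀ {n} {C : Code n} → IsCompleteCode C → ∀ {c d} → c ∈ₗ C → d ∈ₗ C →
                     ∀ {i j} → lookup c i ≡ true → lookup c j ≡ false →
                     lookup d i ≡ false → lookup d j ≡ true → ⊥
complete⇒¬opposite complete {c} {d} c∈C d∈C {i} {j} cᵢ cⱼ dᵢ dⱼ
  with complete c d c∈C d∈C (λ { refl → true≢false (trans (sym cᵢ) dᵢ) })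
... | inj₁ (c⊆d , _) = true≢false (trans (sym ([]=⇒lookup (c⊆d (lookup⇒[]= i c cᵢ)))) dᵢ)
... | inj₂ (d⊆c , _) = true≢false (trans (sym ([]=⇒lookup (d⊆c (lookup⇒[]= j d dⱼ)))) cⱼ)

complete⇒pmPair∈ideal : ∀ {n} {C : Code n} → IsCompleteCode C → ∀ {i j : Fin n} → i ≢ j →
                        InNeuralIdeal C (pmPoly (pmPair i pos j neg))
                        ⊎ InNeuralIdeal C (pmPoly (pmPair i neg j pos))
complete⇒pmPair∈ideal {C = C} complete {i} {j} i≢j
  with any? (λ c → pmValue (pmPair i pos j neg) c Bool.≟ true) C
... | no ∄c = inj₁ (vanishing⇒pmPoly∈ideal C (pmPair i pos j neg) λ c∈C → ¬-not (∄c ∘ lose c∈C))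
... | yes ∃c with find ∃c
...   | c , c∈C , f[c]≡1 = inj₂ (vanishing⇒pmPoly∈ideal C (pmPair i neg j pos) λ {d} d∈C →
          ¬-not λ g[d]≡1 →
            let cᵢ , cⱼ = pmValue-pmPair i≢j pos neg c f[c]≡1
                dᵢ , dⱼ = pmValue-pmPair i≢j neg pos d g[d]≡1
            in complete⇒¬opposite complete c∈C d∈C cᵢ (not-injective cⱼ) (not-injective dᵢ) dⱼ)

mainTheorem15 : (n : ℕ) (C : Code n) → IsCompleteCode C →
                IsCompleteGraph (GVertex C) (GComplAdj C)
mainTheorem15 n C complete i j _ _ i≢j = i≢j , λ (_ , ij∈GR) →
  [ InGR⇒pmPoly∉ideal ij∈GR (pmPair i pos j neg) (pmPair-supported i j pos neg)
  , InGR⇒pmPoly∉ideal ij∈GR (pmPair i neg j pos) (pmPair-supported i j neg pos)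
  ] (complete⇒pmPair∈ideal complete i≢j)
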